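{- If $n$ and $a$ are integers such that $n$ is even, $n\ge 6$, $a$ is odd and $3\le a\le\left\lfloor\frac{n}{2}\right\rfloor$, then $\beta_b(C(n;1,a))=\alpha(C(n;1,a))=\frac{n}{2}$.
   Context: For integers $n\ge 3$ and $1\le a\le\lfloor n/2\rfloor$, the circulant graph $C(n;1,a)$ has vertex set $\{v_0,\dots,v_{n-1}\}$ and edges $v_iv_{i+1}$ and $v_iv_{i+a}$, subscripts modulo $n$. For a connected graph $G$, a broadcast is a function $f:V(G)\to\{0,\dots,\mathrm{diam}(G)\}$ with $f(v)\le e(v)$ (eccentricity) for all $v$; $V_f^+=\{v:f(v)>0\}$. $f$ is independent if $d(u,v)>\max\{f(u),f(v)\}$ for all distinct $u,v\in V_f^+$. The cost is $\sigma(f)=\sum_v f(v)$, and $\beta_b(G)$ is the maximum cost of an independent broadcast on $G$. $\alpha(G)$ denotes the independence number. -}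

module Defs where

open import Data.Nat using (ℕ; zero; suc; _+_; _≤_; _<_; _⊔_)
open import Data.Nat.DivMod using (_%_)
open import Data.Fin using (Fin; toℕ)
open import Data.Fin.Subset using (Subset; _∈_)
open import Data.List using (List; map; allFin)
open import Data.Nat.ListAction using (sum)
open import Data.Product using (Σ; ∃; _×_; _,_)
open import Data.Sum using (_⊎_)
open import Relation.Binary.PropositionalEquality using (_≡_; _≢_)
open import Relation.Nullary using (¬_)

-- Circulant graph C(n;1,a) on vertex set Fin n (v_i ↦ i):
-- v_i ~ v_j iff j ≡ i ± 1 or j ≡ i ± a (mod n).
Step : (n : ℕ) → ℕ → Fin n → Fin n → Set
Step zero s ()
Step (suc m) s i j = toℕ j ≡ (toℕ i + s) % suc m

CAdj : (n a : ℕ) → Fin n → Fin n → Set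
CAdj n a i j = Step n 1 i j ⊎ Step n 1 j i ⊎ Step n a i j ⊎ Step n a j i

module Graph {V : Set} (Adj : V → V → Set) where

  data WalkLe : ℕ → V → V → Set where
    here : ∀ {k v} → WalkLe k v v
    step : ∀ {k u w v} → Adj u w → WalkLe k w v → WalkLe (suc k) u v

  IsDist : V → V → ℕ → Set
  IsDist u v k = WalkLe k u v × (∀ j → WalkLe j u v → k ≤ j)

  IsEcc : V → ℕ → Set
  IsEcc v e = (∀ u d → IsDist v u d → d ≤ e) × ∃ λ u → IsDist v u e

  -- broadcast: f(v) ≤ e(v) for all v (this also gives f(v) ≤ diam)
  IsBroadcast : (V → ℕ) → Set
  IsBroadcast f = ∀ v e → IsEcc v e → f v ≤ e

  IsIndepBroadcast : (V → ℕ) → Set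
  IsIndepBroadcast f = IsBroadcast f ×
    (∀ u v d → u ≢ v → 0 < f u → 0 < f v → IsDist u v d → f u ⊔ f v < d)

  IsIndepSet : (V → Set) → Set
  IsIndepSet S = ∀ u v → S u → S v → ¬ Adj u v

cost : (n : ℕ) → (Fin n → ℕ) → ℕ
cost n f = sum (map f (allFin n))

BroadcastIndepNumberIs : (n a b : ℕ) → Set
BroadcastIndepNumberIs n a b =
  (Σ (Fin n → ℕ) λ f → IsIndepBroadcast f × cost n f ≡ b) ×
  (∀ f → IsIndepBroadcast f → cost n f ≤ b)
  where open Graph (CAdj n a)

IndepNumberIs : (n a b : ℕ) → Set
IndepNumberIs n a b =
  (Σ (Subset n) λ S → IsIndepSet (λ v → v ∈ S) × Data.Fin.Subset.∣ S ∣ ≡ b) ×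
  (∀ (S : Subset n) → IsIndepSet (λ v → v ∈ S) → Data.Fin.Subset.∣ S ∣ ≤ b)
  where open Graph (CAdj n a)

module Submission where

-- The even vertices form an independent set of size n/2: n is even and both generators 1 and a
-- are odd, so every edge joins vertices of opposite parity.  Its indicator is an independent
-- broadcast, whence β_b ≥ α ≥ n/2.
--
-- For β_b ≤ n/2, attach to each broadcasting vertex v with f(v) = k its half-ball: the vertices
-- at distance ≤ ⌊k/2⌋ from v and, for odd k, the cycle successors of those at distance ⌊k/2⌋.
-- Cycle predecessors are unique, so two half-balls sharing a vertex give a walk of length at most
-- max(f(u), f(v)) between their centres; independence therefore makes the half-balls disjoint.
-- Every eccentricity is ≤ n/2, so 2k ≤ n, and then the half-ball of v contains 2k vertices: when
-- ⌊k/2⌋ > (a-1)/2 the chords make all 4⌊k/2⌋+1 cycle positions within 2⌊k/2⌋ of v reachable in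
-- ⌊k/2⌋ steps, and otherwise one takes k+1 cycle positions around v and k-1 around v + a.
-- Counting gives 2 σ(f) ≤ n.

open import Defs
open import Data.Nat using (ℕ; _≤_)
open import Data.Nat.Divisibility using (_∣_; divides)
open import Data.Nat.DivMod using (_/_)
open import Data.Product using (_×_)
open import Relation.Nullary using (¬_)

open import Data.Nat using (zero; suc; _+_; _*_; _∸_; _<_; _⊔_; z≤n; s≤s; _≤?_; _<?_; parity)
open import Data.Nat.Properties
open import Data.Nat.DivMod
  using (_%_; _mod_; m%n<n; m<n⇒m%n≡m; [m+n]%n≡m%n; [m+kn]%n≡m%n; m≡m%n+[m/n]*n; m≤n⇒[n∸m]%m≡n%m; m*n/n≡m)
open import Data.Nat.ListAction using (sum)
open import Data.Nat.Tactic.RingSolver using (solve-∀)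
open import Algebra.Properties.CommutativeSemigroup +-commutativeSemigroup using (xy∙z≈xz∙y)
open import Algebra.Properties.CommutativeMonoid.Sum +-0-commutativeMonoid
  using (∑-distrib-+; sum-cong-≗) renaming (sum to ∑)
open import Data.Parity.Base using (0ℙ; 1ℙ; _⁻¹)
import Data.Parity.Base as ℙ
import Data.Parity.Properties as ℙ
open import Data.Fin using (Fin; toℕ; splitAt; join)
import Data.Fin as Fin
open import Data.Fin.Properties
  using (any?; join-splitAt; injective⇒≤; toℕ-fromℕ<; toℕ-injective; toℕ<n) renaming (_≟_ to _≟ᶠ_)
open import Data.Fin.Subset using (Subset; _∈_; ∣_∣)
open import Data.Bool using (Bool; true; false; T; if_then_else_)
open import Data.Unit using (tt)
open import Data.Product using (Σ; ∃; _,_; proj₁; proj₂)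
import Data.Product as Product
open import Data.Sum using (_⊎_; inj₁; inj₂; [_,_]′)
open import Data.Empty using (⊥-elim)
open import Data.List using (allFin; tabulate)
open import Data.List.Properties using (map-tabulate)
open import Data.List.Relation.Unary.All using (lookup)
open import Data.List.Membership.Propositional.Properties using (∈-allFin)
open import Data.List.Extrema ≤-totalOrder using (argmax; f[xs]≤f[argmax])
import Data.Vec as Vec
open import Data.Vec.Properties using (lookup⇒[]=; []=⇒lookup; lookup∘tabulate)
open import Function using (_∘_; id)
open import Function.Definitions using (Injective)
open import Relation.Binary.Definitions using (Symmetric; Decidable)
open import Relation.Nullary using (Dec; yes; no)
open import Relation.Nullary.Decidable using (_×-dec_; _⊎-dec_; isYes; toWitness)
open import Relation.Binary.PropositionalEquality

data Halving : ℕ → Set where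
  even : ∀ r → Halving (r + r)
  odd  : ∀ r → Halving (suc (r + r))

halving : ∀ k → Halving k
halving zero = even 0
halving (suc zero) = odd 0
halving (suc (suc k)) with halving k
... | even r = subst Halving (cong suc (+-suc r r)) (even (suc r))
... | odd r = subst Halving (cong (suc ∘ suc) (+-suc r r)) (odd (suc r))

half : ∀ {k} → Halving k → ℕ
half (even r) = r
half (odd r) = r

half+half≤ : ∀ {k} (hk : Halving k) → half hk + half hk ≤ k
half+half≤ (even r) = ≤-refl
half+half≤ (odd r) = n≤1+n (r + r)

≤1+half+half : ∀ {k} (hk : Halving k) → k ≤ suc (half hk + half hk)
≤1+half+half (even r) = n≤1+n (r + r)
≤1+half+half (odd r) = ≤-refl

m+m≤n+n⇒m≤n : ∀ {m n} → m + m ≤ n + n → m ≤ n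
m+m≤n+n⇒m≤n m+m≤n+n = ≮⇒≥ λ n<m → <⇒≱ (+-mono-< n<m n<m) m+m≤n+n

m<[1+n]+[1+n]⇒m≤1+[n+n] : ∀ {m n} → m < suc n + suc n → m ≤ suc (n + n)
m<[1+n]+[1+n]⇒m≤1+[n+n] {n = n} m< = ≤-trans (≤-pred m<) (≤-reflexive (+-suc n n))

+-shift-≤ : ∀ c {x y w} → x ≤ y + w → c + x ≤ c + y + w
+-shift-≤ c {y = y} {w} x≤ = ≤-trans (+-monoʳ-≤ c x≤) (≤-reflexive (sym (+-assoc c y w)))

n≤m<n+n⇒m∸n<n : ∀ {m n} → n ≤ m → m < n + n → m ∸ n < n
n≤m<n+n⇒m∸n<n {m} {n} n≤m m< = subst (m ∸ n <_) (m+n∸n≡m n n) (∸-monoˡ-< m< n≤m)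

parity-odd : ∀ x → parity (suc (x + x)) ≡ 1ℙ
parity-odd zero = refl
parity-odd (suc x) = trans (cong parity (+-suc x x)) (parity-odd x)

⁻¹-swap : ∀ {p q} → p ≡ q ⁻¹ → q ≡ p ⁻¹
⁻¹-swap {q = q} eq = trans (sym (ℙ.⁻¹-involutive q)) (cong _⁻¹ (sym eq))

halves-+≤⊔ : ∀ {r s k l} → r + r ≤ k → s + s ≤ l → r + s ≤ k ⊔ l
halves-+≤⊔ {r} {s} {k} {l} r+r≤k s+s≤l with ≤-total r s
... | inj₁ r≤s = ≤-trans (+-monoˡ-≤ s r≤s) (≤-trans s+s≤l (m≤n⊔m k l))
... | inj₂ s≤r = ≤-trans (+-monoʳ-≤ r s≤r) (≤-trans r+r≤k (m≤m⊔n k l))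

halves-+suc≤⊔ : ∀ {r s l} → s + s ≤ l → r + suc s ≤ suc (r + r) ⊔ l
halves-+suc≤⊔ {r} {s} {l} s+s≤l with s ≤? r
... | yes s≤r = ≤-trans (+-monoʳ-≤ r (s≤s s≤r)) (≤-trans (≤-reflexive (+-suc r r)) (m≤m⊔n _ l))
... | no s≰r =
  ≤-trans (≤-reflexive (+-suc r s)) (≤-trans (+-monoˡ-≤ s (≰⇒> s≰r)) (≤-trans s+s≤l (m≤n⊔m _ l)))

module Walks {V : Set} (Adj : V → V → Set) where
  open Graph Adj

  walk-mono : ∀ {j k u v} → j ≤ k → WalkLe j u v → WalkLe k u v
  walk-mono _ here = here
  walk-mono (s≤s j≤k) (step x w) = step x (walk-mono j≤k w)

  _++ʷ_ : ∀ {j k u w v} → WalkLe j u w → WalkLe k w v → WalkLe (j + k) u v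
  _++ʷ_ {j} {k} here q = walk-mono (m≤n+m k j) q
  step x p ++ʷ q = step x (p ++ʷ q)

  walk-snoc : ∀ {k u w v} → WalkLe k u w → Adj w v → WalkLe (suc k) u v
  walk-snoc here x = step x here
  walk-snoc (step y p) x = step y (walk-snoc p x)

  walk-reverse : Symmetric Adj → ∀ {k u v} → WalkLe k u v → WalkLe k v u
  walk-reverse adj-sym here = here
  walk-reverse adj-sym (step x p) = walk-snoc (walk-reverse adj-sym p) (adj-sym x)

  walk₀⇒≡ : ∀ {u v} → WalkLe 0 u v → u ≡ v
  walk₀⇒≡ here = refl

  walk₁⇒≡⊎adj : ∀ {u v} → WalkLe 1 u v → u ≡ v ⊎ Adj u v
  walk₁⇒≡⊎adj here = inj₁ refl
  walk₁⇒≡⊎adj (step x here) = inj₂ x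

  distinct-nonadjacent⇒dist>1 : ∀ {u v d} → u ≢ v → ¬ Adj u v → IsDist u v d → 1 < d
  distinct-nonadjacent⇒dist>1 {d = zero} u≢v _ (w , _) = ⊥-elim (u≢v (walk₀⇒≡ w))
  distinct-nonadjacent⇒dist>1 {d = suc zero} u≢v ¬adj (w , _) with walk₁⇒≡⊎adj w
  ... | inj₁ u≡v = ⊥-elim (u≢v u≡v)
  ... | inj₂ adj = ⊥-elim (¬adj adj)
  distinct-nonadjacent⇒dist>1 {d = suc (suc d)} _ _ _ = s≤s (s≤s z≤n)

  dist-unique : ∀ {u v d d′} → IsDist u v d → IsDist u v d′ → d ≡ d′
  dist-unique (w , min) (w′ , min′) = ≤-antisym (min _ w′) (min′ _ w)

cost≡∑ : ∀ n (f : Fin n → ℕ) → cost n f ≡ ∑ f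
cost≡∑ n f = trans (cong sum (map-tabulate id f)) (sum-tabulate f)
  where
  sum-tabulate : ∀ {k} (g : Fin k → ℕ) → sum (tabulate g) ≡ ∑ g
  sum-tabulate {zero} g = refl
  sum-tabulate {suc k} g = cong (g Fin.zero +_) (sum-tabulate (g ∘ Fin.suc))

module _ {k : ℕ} (g : Fin (suc k) → ℕ) where
  Σ-suc : Σ (Fin k) (Fin ∘ g ∘ Fin.suc) → Σ (Fin (suc k)) (Fin ∘ g)
  Σ-suc (v , i) = Fin.suc v , i

  Σ-suc-injective : Injective _≡_ _≡_ Σ-suc
  Σ-suc-injective {_ , _} {_ , _} refl = refl

unpair : ∀ {k} (g : Fin k → ℕ) → Fin (∑ g) → Σ (Fin k) (Fin ∘ g)
unpair {suc k} g i = [ (Fin.zero ,_) , Σ-suc g ∘ unpair (g ∘ Fin.suc) ]′ (splitAt (g Fin.zero) i)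

unpair-injective : ∀ {k} (g : Fin k → ℕ) → Injective _≡_ _≡_ (unpair g)
unpair-injective {suc k} g {i} {j} eq = begin
  i                                  ≡⟨ join-splitAt (g Fin.zero) _ i ⟨
  join _ _ (splitAt (g Fin.zero) i)  ≡⟨ cong (join _ _) (cases (splitAt _ i) (splitAt _ j) eq) ⟩
  join _ _ (splitAt (g Fin.zero) j)  ≡⟨ join-splitAt (g Fin.zero) _ j ⟩
  j                                  ∎
  where
  open ≡-Reasoning
  cases : ∀ x y → [ (Fin.zero ,_) , Σ-suc g ∘ unpair (g ∘ Fin.suc) ]′ x
                ≡ [ (Fin.zero ,_) , Σ-suc g ∘ unpair (g ∘ Fin.suc) ]′ y → x ≡ y
  cases (inj₁ x) (inj₁ .x) refl = refl
  cases (inj₂ x) (inj₂ y) eq′ =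
    cong inj₂ (unpair-injective (g ∘ Fin.suc) (Σ-suc-injective g eq′))

∑≤-by-injection : ∀ {k n} (g : Fin k → ℕ) {Φ : Σ (Fin k) (Fin ∘ g) → Fin n} →
                  Injective _≡_ _≡_ Φ → ∑ g ≤ n
∑≤-by-injection g Φ-injective = injective⇒≤ (unpair-injective g ∘ Φ-injective)

indicator : ∀ {n} → Subset n → Fin n → ℕ
indicator S v = if Vec.lookup S v then 1 else 0

∣p∣≡∑indicator : ∀ {n} (p : Subset n) → ∣ p ∣ ≡ ∑ (indicator p)
∣p∣≡∑indicator Vec.[] = refl
∣p∣≡∑indicator (true Vec.∷ p) = cong suc (∣p∣≡∑indicator p)
∣p∣≡∑indicator (false Vec.∷ p) = ∣p∣≡∑indicator p

module FiniteGraph {n : ℕ} (Adj : Fin n → Fin n → Set) (adj? : Decidable Adj) where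
  open Graph Adj
  open Walks Adj

  walk? : ∀ k u v → Dec (WalkLe k u v)
  walk? k u v with u ≟ᶠ v
  walk? k u v | yes refl = yes here
  walk? zero u v | no u≢v = no (u≢v ∘ walk₀⇒≡)
  walk? (suc k) u v | no u≢v with any? (λ w → adj? u w ×-dec walk? k w v)
  ... | yes (w , x , p) = yes (step x p)
  ... | no ¬step = no λ { here → u≢v refl ; (step x p) → ¬step (_ , x , p) }

  walk⇒dist : ∀ {L u v} → WalkLe L u v → ∃ λ d → IsDist u v d × d ≤ L
  walk⇒dist {zero} w = 0 , (w , λ _ _ → z≤n) , z≤n
  walk⇒dist {suc L} {u} {v} w with walk? L u v
  ... | yes w′ = Product.map₂ (Product.map₂ m≤n⇒m≤1+n) (walk⇒dist w′)
  ... | no ¬w′ = suc L , (w , minimal) , ≤-refl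
    where
    minimal : ∀ j → WalkLe j u v → suc L ≤ j
    minimal j w″ with j ≤? L
    ... | yes j≤L = ⊥-elim (¬w′ (walk-mono j≤L w″))
    ... | no j≰L = ≰⇒> j≰L

  ecc-exists : ∀ {D} → (∀ u v → WalkLe D u v) → ∀ v → ∃ λ e → IsEcc v e × e ≤ D
  ecc-exists connected v = dist far , (bounded , far , isDist far) , dist≤D far
    where
    dist : Fin n → ℕ
    dist u = proj₁ (walk⇒dist (connected v u))
    isDist : ∀ u → IsDist v u (dist u)
    isDist u = proj₁ (proj₂ (walk⇒dist (connected v u)))
    dist≤D : ∀ u → dist u ≤ _
    dist≤D u = proj₂ (proj₂ (walk⇒dist (connected v u)))
    far : Fin n
    far = argmax dist v (allFin n)
    bounded : ∀ u d → IsDist v u d → d ≤ dist far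
    bounded u d D = subst (_≤ dist far) (dist-unique (isDist u) D)
                      (lookup (f[xs]≤f[argmax] v (allFin n)) (∈-allFin u))

  broadcast≤diameter : ∀ {D f} → (∀ u v → WalkLe D u v) → IsBroadcast f → ∀ v → f v ≤ D
  broadcast≤diameter connected broadcast v =
    ≤-trans (broadcast v _ (proj₁ (proj₂ ecc))) (proj₂ (proj₂ ecc))
    where
    ecc : ∃ λ e → IsEcc v e × e ≤ _
    ecc = ecc-exists connected v

  ecc-positive : ∀ {L u v e} → u ≢ v → WalkLe L v u → IsEcc v e → 1 ≤ e
  ecc-positive {u = u} {v} u≢v w (bounded , _) with walk⇒dist w
  ... | zero , (w₀ , _) , _ = ⊥-elim (u≢v (sym (walk₀⇒≡ w₀)))
  ... | suc d , D , _ = ≤-trans (s≤s z≤n) (bounded u (suc d) D)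

  indicator-indepBroadcast : (∀ v e → IsEcc v e → 1 ≤ e) → ∀ {S} → IsIndepSet (_∈ S) →
                             IsIndepBroadcast (indicator S)
  indicator-indepBroadcast ecc≥1 {S} independent =
    (λ v e E → ≤-trans (indicator≤1 v) (ecc≥1 v e E)) ,
    λ u v d u≢v u∈ v∈ D → ≤-<-trans (⊔-lub (indicator≤1 u) (indicator≤1 v))
      (distinct-nonadjacent⇒dist>1 u≢v (independent u v (pos⇒∈ u u∈) (pos⇒∈ v v∈)) D)
    where
    indicator≤1 : ∀ v → indicator S v ≤ 1
    indicator≤1 v with Vec.lookup S v
    ... | true = ≤-refl
    ... | false = z≤n
    pos⇒∈ : ∀ v → 0 < indicator S v → v ∈ S
    pos⇒∈ v pos with Vec.lookup S v in eq
    ... | true = lookup⇒[]= v S eq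

module HalfBalls {V : Set} (Adj : V → V → Set) (adj-sym : Symmetric Adj)
  (Succ : V → V → Set) (succ⇒adj : ∀ {u v} → Succ u v → Adj u v)
  (succ-injective : ∀ {u u′ v} → Succ u v → Succ u′ v → u ≡ u′) where
  open Graph Adj
  open Walks Adj

  data InHalfBall (v : V) : ℕ → V → Set where
    near   : ∀ {r k w} → r + r ≤ k → WalkLe r v w → InHalfBall v k w
    beyond : ∀ {r w′ w} → WalkLe r v w′ → Succ w′ w → InHalfBall v (suc (r + r)) w

  halfBalls-meet : ∀ {u v k l w} → InHalfBall v k w → InHalfBall u l w →
                   ∃ λ L → WalkLe L v u × L ≤ k ⊔ l
  halfBalls-meet (near {r} r≤ p) (near {s} s≤ q) =
    r + s , p ++ʷ walk-reverse adj-sym q , halves-+≤⊔ {r} {s} r≤ s≤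
  halfBalls-meet (beyond {r} p x) (near {s} s≤ q) =
    r + suc s , p ++ʷ step (succ⇒adj x) (walk-reverse adj-sym q) , halves-+suc≤⊔ s≤
  halfBalls-meet {k = k} {l} n@(near _ _) b@(beyond _ _) with halfBalls-meet b n
  ... | L , w , L≤ = L , walk-reverse adj-sym w , subst (L ≤_) (⊔-comm l k) L≤
  halfBalls-meet (beyond {r} p x) (beyond {s} q y) with succ-injective x y
  ... | refl = r + s , p ++ʷ walk-reverse adj-sym q , halves-+≤⊔ {r} {s} (n≤1+n (r + r)) (n≤1+n (s + s))

module Packing {n : ℕ} (Adj : Fin n → Fin n → Set) (adj? : Decidable Adj) (adj-sym : Symmetric Adj)
  (Succ : Fin n → Fin n → Set) (succ⇒adj : ∀ {u v} → Succ u v → Adj u v)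
  (succ-injective : ∀ {u u′ v} → Succ u v → Succ u′ v → u ≡ u′) where
  open Graph Adj
  open FiniteGraph Adj adj?
  open HalfBalls Adj adj-sym Succ succ⇒adj succ-injective public

  record LargeHalfBall (v : Fin n) (k : ℕ) : Set where
    field
      member : Fin (k + k) → Fin n
      member-injective : Injective _≡_ _≡_ member
      member-inHalfBall : ∀ t → InHalfBall v k (member t)

  independent⇒halfBalls-disjoint : ∀ {f} → IsIndepBroadcast f → ∀ {u v w} → v ≢ u → 0 < f v → 0 < f u →
                                   InHalfBall v (f v) w → ¬ InHalfBall u (f u) w
  independent⇒halfBalls-disjoint {f} (_ , independent) {u} {v} v≢u fv>0 fu>0 w∈v w∈u
    with halfBalls-meet w∈v w∈u
  ... | L , w , L≤ with walk⇒dist w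
  ...   | d , D , d≤L = <⇒≱ (independent v u d v≢u fv>0 fu>0 D) (≤-trans d≤L L≤)

  packing : ∀ {f} → IsIndepBroadcast f → (∀ v → LargeHalfBall v (f v)) → cost n f + cost n f ≤ n
  packing {f} f-indep large = begin
    cost n f + cost n f    ≡⟨ cong₂ _+_ (cost≡∑ n f) (cost≡∑ n f) ⟩
    ∑ f + ∑ f              ≡⟨ ∑-distrib-+ f f ⟨
    ∑ (λ v → f v + f v)    ≤⟨ ∑≤-by-injection (λ v → f v + f v) Φ-injective ⟩
    n                      ∎
    where
    open ≤-Reasoning
    open LargeHalfBall
    Φ : Σ (Fin n) (λ v → Fin (f v + f v)) → Fin n
    Φ (v , t) = member (large v) t
    positive : ∀ {k} → Fin (k + k) → 0 < k
    positive {suc k} _ = s≤s z≤n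
    Φ-injective : Injective _≡_ _≡_ Φ
    Φ-injective {v , t} {u , s} eq with v ≟ᶠ u
    ... | yes refl = cong (v ,_) (member-injective (large v) eq)
    ... | no v≢u = ⊥-elim (independent⇒halfBalls-disjoint f-indep v≢u (positive t) (positive s)
                     (member-inHalfBall (large v) t)
                     (subst (InHalfBall u (f u)) (sym eq) (member-inHalfBall (large u) s)))

-- The order is written suc m so that Step n computes; a = 2h + 1 and M = n/2.
module Circulant (m h M : ℕ) (n≡M+M : suc m ≡ M + M) (1≤h : 1 ≤ h) (a≤M : suc (h + h) ≤ M) where
  n a : ℕ
  n = suc m
  a = suc (h + h)

  open Graph (CAdj n a)
  open Walks (CAdj n a)

  ι : ℕ → Fin n
  ι N = N mod n

  toℕ-ι : ∀ N → toℕ (ι N) ≡ N % n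
  toℕ-ι N = toℕ-fromℕ< (m%n<n N n)

  ι-toℕ : ∀ v → ι (toℕ v) ≡ v
  ι-toℕ v = toℕ-injective (trans (toℕ-ι (toℕ v)) (m<n⇒m%n≡m (toℕ<n v)))

  ι-+n : ∀ N → ι (N + n) ≡ ι N
  ι-+n N = toℕ-injective (trans (toℕ-ι (N + n)) (trans ([m+n]%n≡m%n N n) (sym (toℕ-ι N))))

  [x%n+d]%n≡[x+d]%n : ∀ x d → (x % n + d) % n ≡ (x + d) % n
  [x%n+d]%n≡[x+d]%n x d = begin
    (x % n + d) % n               ≡⟨ [m+kn]%n≡m%n (x % n + d) (x / n) n ⟨
    (x % n + d + x / n * n) % n   ≡⟨ cong (_% n) (xy∙z≈xz∙y (x % n) d (x / n * n)) ⟩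
    (x % n + x / n * n + d) % n   ≡⟨ cong (λ y → (y + d) % n) (m≡m%n+[m/n]*n x n) ⟨
    (x + d) % n                   ∎
    where open ≡-Reasoning

  ι-step : ∀ N s → Step n s (ι N) (ι (N + s))
  ι-step N s = begin
    toℕ (ι (N + s))       ≡⟨ toℕ-ι (N + s) ⟩
    (N + s) % n           ≡⟨ [x%n+d]%n≡[x+d]%n N s ⟨
    (N % n + s) % n       ≡⟨ cong (λ y → (y + s) % n) (toℕ-ι N) ⟨
    (toℕ (ι N) + s) % n   ∎
    where open ≡-Reasoning

  %-translate≡⇒0 : ∀ {x d} → d < n → (x + d) % n ≡ x % n → d ≡ 0
  %-translate≡⇒0 {x} {d} d<n eq = reduced (m%n<n x n) (trans ([x%n+d]%n≡[x+d]%n x d) eq)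
    where
    reduced : ∀ {y} → y < n → (y + d) % n ≡ y → d ≡ 0
    reduced {y} y<n eq′ with y + d <? n
    ... | yes y+d<n = +-cancelˡ-≡ y d 0 (trans (sym (m<n⇒m%n≡m y+d<n)) (trans eq′ (sym (+-identityʳ y))))
    ... | no y+d≮n = ⊥-elim (<-irrefl d≡n d<n)
      where
      n≤y+d : n ≤ y + d
      n≤y+d = ≮⇒≥ y+d≮n
      y+d∸n<n : y + d ∸ n < n
      y+d∸n<n = subst (y + d ∸ n <_) (m+n∸n≡m n n) (∸-monoˡ-< (+-mono-< y<n d<n) n≤y+d)
      wrapped : y + d ∸ n ≡ y
      wrapped = trans (sym (m<n⇒m%n≡m y+d∸n<n)) (trans (m≤n⇒[n∸m]%m≡n%m n≤y+d) eq′)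
      d≡n : d ≡ n
      d≡n = +-cancelˡ-≡ y d n (trans (sym (m∸n+n≡m n≤y+d)) (cong (_+ n) wrapped))

  ι-+-cancelˡ-≤ : ∀ {B p q} → p ≤ q → q < n → ι (B + p) ≡ ι (B + q) → p ≡ q
  ι-+-cancelˡ-≤ {B} {p} p≤q q<n eq with m≤n⇒∃[o]m+o≡n p≤q
  ... | d , refl = sym (trans (cong (p +_) d≡0) (+-identityʳ p))
    where
    d≡0 : d ≡ 0
    d≡0 = %-translate≡⇒0 {B + p} (≤-<-trans (m≤n+m d p) q<n)
            (trans (cong (_% n) (+-assoc B p d))
              (sym (trans (sym (toℕ-ι (B + p))) (trans (cong toℕ eq) (toℕ-ι (B + (p + d)))))))

  ι-+-cancelˡ : ∀ {B p q} → p < n → q < n → ι (B + p) ≡ ι (B + q) → p ≡ q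
  ι-+-cancelˡ {B} {p} {q} p<n q<n eq with ≤-total p q
  ... | inj₁ p≤q = ι-+-cancelˡ-≤ {B} p≤q q<n eq
  ... | inj₂ q≤p = sym (ι-+-cancelˡ-≤ {B} q≤p p<n (sym eq))

  step-injective : ∀ {u u′ v} → Step n 1 u v → Step n 1 u′ v → u ≡ u′
  step-injective {u} {u′} st st′ =
    toℕ-injective (ι-+-cancelˡ {1} (toℕ<n u) (toℕ<n u′) (trans (landing st) (sym (landing st′))))
    where
    landing : ∀ {w v} → Step n 1 w v → ι (1 + toℕ w) ≡ v
    landing {w} st″ =
      toℕ-injective (trans (toℕ-ι (1 + toℕ w)) (trans (cong (_% n) (+-comm 1 (toℕ w))) (sym st″)))

  adj-sym : Symmetric (CAdj n a)
  adj-sym (inj₁ st) = inj₂ (inj₁ st)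
  adj-sym (inj₂ (inj₁ st)) = inj₁ st
  adj-sym (inj₂ (inj₂ (inj₁ st))) = inj₂ (inj₂ (inj₂ st))
  adj-sym (inj₂ (inj₂ (inj₂ st))) = inj₂ (inj₂ (inj₁ st))

  adj? : Decidable (CAdj n a)
  adj? i j = step? 1 i j ⊎-dec step? 1 j i ⊎-dec step? a i j ⊎-dec step? a j i
    where
    step? : ∀ s → Decidable (Step n s)
    step? s i j = toℕ j ≟ (toℕ i + s) % n

  Hop : ℕ → ℕ → ℕ → Set
  Hop L c t = ∀ s → WalkLe L (ι (s + c)) (ι (s + t))

  hop-refl : ∀ {c} → Hop 0 c c
  hop-refl _ = here

  hop-trans : ∀ {j k c d t} → Hop j c d → Hop k d t → Hop (j + k) c t
  hop-trans p q s = p s ++ʷ q s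

  hop-sym : ∀ {k c t} → Hop k c t → Hop k t c
  hop-sym p s = walk-reverse adj-sym (p s)

  hop-mono : ∀ {j k c t} → j ≤ k → Hop j c t → Hop k c t
  hop-mono j≤k p s = walk-mono j≤k (p s)

  ι-suc : ∀ N → Step n 1 (ι N) (ι (suc N))
  ι-suc N = subst (Step n 1 (ι N) ∘ ι) (+-comm N 1) (ι-step N 1)

  hop-cycle : ∀ c → Hop 1 c (suc c)
  hop-cycle c s = step (inj₁ (subst (Step n 1 (ι (s + c)) ∘ ι) (sym (+-suc s c)) (ι-suc (s + c)))) here

  hop-chord : ∀ c → Hop 1 c (c + a)
  hop-chord c s =
    step (inj₂ (inj₂ (inj₁ (subst (Step n a (ι (s + c)) ∘ ι) (+-assoc s c a) (ι-step (s + c) a))))) here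

  hop-wrap : ∀ {k c t} → Hop k c (t + n) → Hop k c t
  hop-wrap {t = t} p s = subst (WalkLe _ _) (trans (cong ι (sym (+-assoc s t n))) (ι-+n (s + t))) (p s)

  hop-forward : ∀ c x → Hop x c (c + x)
  hop-forward c zero = subst (Hop 0 c) (sym (+-identityʳ c)) hop-refl
  hop-forward c (suc x) = subst (Hop (suc x) c) (sym (+-suc c x)) (hop-trans (hop-cycle c) (hop-forward (suc c) x))

  hop-walk : ∀ {L u v} → Hop L (toℕ u) (toℕ v) → WalkLe L u v
  hop-walk {u = u} {v} p = subst₂ (WalkLe _) (ι-toℕ u) (ι-toℕ v) (p 0)

  Span : ℕ → ℕ → Set
  Span L w = ∀ c x → x ≤ w → Hop L c (c + x)

  span-cycle : ∀ w → Span w w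
  span-cycle w c x x≤w = hop-mono x≤w (hop-forward c x)

  span-interval : ∀ {L w c t} → Span L w → t ≤ c + w → c ≤ t + w → Hop L c t
  span-interval {L} {w} {c} {t} span t≤c+w c≤t+w with ≤-total c t
  ... | inj₁ c≤t = forward (m≤n⇒∃[o]m+o≡n c≤t)
    where
    forward : (∃ λ x → c + x ≡ t) → Hop L c t
    forward (x , refl) = span c x (+-cancelˡ-≤ c x w t≤c+w)
  ... | inj₂ t≤c = backward (m≤n⇒∃[o]m+o≡n t≤c)
    where
    backward : (∃ λ x → t + x ≡ c) → Hop L c t
    backward (x , refl) = hop-sym (span t x (+-cancelˡ-≤ t x w c≤t+w))

  hop-via-chord : ∀ {L w c t} → Span L w → t ≤ c + a + w → c + a ≤ t + w → Hop (suc L) c t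
  hop-via-chord span t≤ c+a≤ = hop-trans (hop-chord _) (span-interval span t≤ c+a≤)

  2≤a : 2 ≤ a
  2≤a = s≤s (≤-trans 1≤h (m≤m+n h h))

  a≤n : a ≤ n
  a≤n = ≤-trans a≤M (≤-trans (m≤m+n M M) (≤-reflexive (sym n≡M+M)))

  span-base : Span (suc h) (suc h + suc h)
  span-base c x x≤ with x ≤? suc h
  ... | yes x≤1+h = span-cycle (suc h) c x x≤1+h
  ... | no x≰1+h = hop-via-chord (span-cycle h) (+-shift-≤ c x≤a+h) (+-shift-≤ c a≤x+h)
    where
    x≤a+h : x ≤ a + h
    x≤a+h = ≤-trans x≤ (≤-trans (≤-reflexive (trans (+-suc (suc h) h) (+-comm 1 a))) (+-monoʳ-≤ a 1≤h))
    a≤x+h : a ≤ x + h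
    a≤x+h = ≤-trans (n≤1+n a) (+-monoˡ-≤ h (≰⇒> x≰1+h))

  span-wide : ∀ r → h < r → Span r (r + r)
  span-wide (suc r) h<1+r with h <? r
  ... | no h≮r = subst (λ r → Span (suc r) (suc r + suc r)) (≤-antisym (≤-pred h<1+r) (≮⇒≥ h≮r)) span-base
  ... | yes h<r = extend
    where
    ih : Span r (r + r)
    ih = span-wide r h<r
    extend : Span (suc r) (suc r + suc r)
    extend c x x≤ with x <? a
    ... | yes x<a = hop-mono (n≤1+n r) (ih c x (≤-trans (≤-pred x<a) (+-mono-≤ (<⇒≤ h<r) (<⇒≤ h<r))))
    ... | no x≮a =
      hop-via-chord ih (+-shift-≤ c x≤a+2r) (+-shift-≤ c (≤-trans (≮⇒≥ x≮a) (m≤m+n x (r + r))))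
      where
      x≤a+2r : x ≤ a + (r + r)
      x≤a+2r = ≤-trans x≤ (≤-trans (≤-reflexive (+-suc (suc r) r)) (+-monoˡ-≤ (r + r) 2≤a))

  hop-around : ∀ {p q} → p < n → q + M < p → Hop M p q
  hop-around {p} {q} p<n q+M<p = hop-wrap (span-interval (span-cycle M) q+n≤p+M p≤q+n+M)
    where
    q+n≤p+M : q + n ≤ p + M
    q+n≤p+M = ≤-trans (≤-reflexive (trans (cong (q +_) n≡M+M) (sym (+-assoc q M M)))) (+-monoˡ-≤ M (<⇒≤ q+M<p))
    p≤q+n+M : p ≤ q + n + M
    p≤q+n+M = ≤-trans (<⇒≤ p<n) (≤-trans (m≤n+m n q) (m≤m+n (q + n) M))

  hop-≤M : ∀ {p q} → p < n → q < n → Hop M p q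
  hop-≤M {p} {q} p<n q<n with q ≤? p + M | p ≤? q + M
  ... | yes q≤p+M | yes p≤q+M = span-interval (span-cycle M) q≤p+M p≤q+M
  ... | no q≰p+M | _ = hop-sym (hop-around q<n (≰⇒> q≰p+M))
  ... | yes _ | no p≰q+M = hop-around p<n (≰⇒> p≰q+M)

  walk≤M : ∀ u v → WalkLe M u v
  walk≤M u v = hop-walk (hop-≤M (toℕ<n u) (toℕ<n v))

  open FiniteGraph (CAdj n a) adj?

  ecc≥1 : ∀ v e → IsEcc v e → 1 ≤ e
  ecc≥1 v e = ecc-positive {L = 1} successor≢v
    (step (inj₁ (subst (λ w → Step n 1 w successor) (ι-toℕ v) (ι-suc (toℕ v)))) here)
    where
    successor : Fin n
    successor = ι (suc (toℕ v))
    successor≢v : successor ≢ v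
    successor≢v eq = 1+n≢0 (ι-+-cancelˡ {toℕ v} (≤-trans 2≤a a≤n) (≤-trans (s≤s z≤n) (≤-trans 2≤a a≤n))
      (trans (cong ι (+-comm (toℕ v) 1)) (trans eq (trans (sym (ι-toℕ v)) (cong ι (sym (+-identityʳ (toℕ v))))))))

  open Packing (CAdj n a) adj? adj-sym (Step n 1) inj₁ step-injective

  HalfHop : ℕ → ℕ → ℕ → Set
  HalfHop k c t = ∀ s → InHalfBall (ι (s + c)) k (ι (s + t))

  halfHop-near : ∀ {r k c t} → r + r ≤ k → Hop r c t → HalfHop k c t
  halfHop-near r+r≤k p s = near r+r≤k (p s)

  halfHop-beyond : ∀ {r c t} → Hop r c t → HalfHop (suc (r + r)) c (suc t)
  halfHop-beyond {t = t} p s = beyond (p s) (subst (Step n 1 (ι (s + t)) ∘ ι) (sym (+-suc s t)) (ι-suc (s + t)))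

  largeHalfBall-of-offsets : ∀ {k} c → c ≤ n → (pos : Fin (k + k) → ℕ) → Injective _≡_ _≡_ pos →
                             (∀ t → pos t < n) → (∀ t → HalfHop k c (pos t)) → ∀ v → LargeHalfBall v k
  largeHalfBall-of-offsets {k} c c≤n pos pos-injective pos<n halfHop v = record
    { member = λ t → ι (s + pos t)
    ; member-injective = λ eq → pos-injective (ι-+-cancelˡ {s} (pos<n _) (pos<n _) eq)
    ; member-inHalfBall = λ t → subst (λ u → InHalfBall u k (ι (s + pos t))) center (halfHop t s)
    }
    where
    s : ℕ
    s = toℕ v + (n ∸ c)
    center : ι (s + c) ≡ v
    center = trans (cong ι (trans (+-assoc (toℕ v) (n ∸ c) c) (cong (toℕ v +_) (m∸n+n≡m c≤n))))
                   (trans (ι-+n (toℕ v)) (ι-toℕ v))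

  wide-hop : ∀ {r t} → h < r → t ≤ (r + r) + (r + r) → Hop r (r + r) t
  wide-hop {r} {t} h<r t≤ = span-interval (span-wide r h<r) t≤ (m≤n+m (r + r) t)

  wide-halfHop : ∀ {k t} (hk : Halving k) → h < half hk → t < k + k → HalfHop k (half hk + half hk) t
  wide-halfHop (even r) h<r t< = halfHop-near ≤-refl (wide-hop h<r (<⇒≤ t<))
  wide-halfHop (odd r) h<r t< with m≤n⇒m<n∨m≡n (m<[1+n]+[1+n]⇒m≤1+[n+n] t<)
  ... | inj₁ t<1+4r = halfHop-near (n≤1+n (r + r)) (wide-hop h<r (≤-pred t<1+4r))
  ... | inj₂ refl = halfHop-beyond (wide-hop h<r ≤-refl)

  narrowOffset : ℕ → ℕ → ℕ
  narrowOffset k t with t ≤? k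
  ... | yes _ = t
  ... | no _ = a + (t ∸ k)

  narrowOffset-inner : ∀ {k t} → t ≤ k → narrowOffset k t ≡ t
  narrowOffset-inner {k} {t} t≤k with t ≤? k
  ... | yes _ = refl
  ... | no t≰k = ⊥-elim (t≰k t≤k)

  narrowOffset-outer : ∀ {k t} → k < t → narrowOffset k t ≡ a + (t ∸ k)
  narrowOffset-outer {k} {t} k<t with t ≤? k
  ... | yes t≤k = ⊥-elim (<⇒≱ k<t t≤k)
  ... | no _ = refl

  narrowOffset-inner<outer : ∀ {k s t} → k ≤ a → s ≤ k → k < t → narrowOffset k s < narrowOffset k t
  narrowOffset-inner<outer {k} {s} {t} k≤a s≤k k<t =
    subst₂ _<_ (sym (narrowOffset-inner s≤k)) (sym (narrowOffset-outer k<t))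
      (≤-<-trans (≤-trans s≤k k≤a) (m<m+n a (m<n⇒0<n∸m k<t)))

  narrowOffset-injective : ∀ {k} → k ≤ a → Injective _≡_ _≡_ (narrowOffset k)
  narrowOffset-injective {k} k≤a {s} {t} eq = cases (s ≤? k) (t ≤? k)
    where
    cases : Dec (s ≤ k) → Dec (t ≤ k) → s ≡ t
    cases (yes s≤k) (yes t≤k) = trans (sym (narrowOffset-inner s≤k)) (trans eq (narrowOffset-inner t≤k))
    cases (yes s≤k) (no t≰k) = ⊥-elim (<⇒≢ (narrowOffset-inner<outer k≤a s≤k (≰⇒> t≰k)) eq)
    cases (no s≰k) (yes t≤k) = ⊥-elim (<⇒≢ (narrowOffset-inner<outer k≤a t≤k (≰⇒> s≰k)) (sym eq))
    cases (no s≰k) (no t≰k) = ∸-cancelʳ-≡ (<⇒≤ (≰⇒> s≰k)) (<⇒≤ (≰⇒> t≰k))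
      (+-cancelˡ-≡ a _ _
        (trans (sym (narrowOffset-outer (≰⇒> s≰k))) (trans eq (narrowOffset-outer (≰⇒> t≰k)))))

  narrowOffset<n : ∀ {k t} → k + k ≤ n → t < k + k → narrowOffset k t < n
  narrowOffset<n {k} {t} k+k≤n t< = cases (t ≤? k)
    where
    a+k≤n : a + k ≤ n
    a+k≤n = subst (a + k ≤_) (sym n≡M+M) (+-mono-≤ a≤M (m+m≤n+n⇒m≤n (subst (k + k ≤_) n≡M+M k+k≤n)))
    cases : Dec (t ≤ k) → narrowOffset k t < n
    cases (yes t≤k) = subst (_< n) (sym (narrowOffset-inner t≤k)) (<-≤-trans t< k+k≤n)
    cases (no t≰k) = subst (_< n) (sym (narrowOffset-outer (≰⇒> t≰k)))
      (<-≤-trans (+-monoʳ-< a (n≤m<n+n⇒m∸n<n (<⇒≤ (≰⇒> t≰k)) t<)) a+k≤n)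

  narrow-hop-inner : ∀ {r t} → t ≤ r + r → Hop r r t
  narrow-hop-inner {r} {t} t≤ = span-interval (span-cycle r) t≤ (m≤n+m r t)

  narrow-hop-outer : ∀ {r j} → 1 ≤ j → j ≤ suc (r + r) → Hop (suc r) (suc r) (a + j)
  narrow-hop-outer {r} {j} 1≤j j≤ = hop-via-chord (span-cycle r)
    (≤-trans (+-monoʳ-≤ a j≤) (≤-reflexive (rearrange a r)))
    (≤-trans (≤-reflexive (+-comm (suc r) a))
      (≤-trans (+-monoʳ-≤ a (+-monoˡ-≤ r 1≤j)) (≤-reflexive (sym (+-assoc a j r)))))
    where
    rearrange : ∀ a r → a + suc (r + r) ≡ suc r + a + r
    rearrange = solve-∀

  narrow-halfHop : ∀ {k t} (hk : Halving k) → t < k + k → HalfHop k (half hk) (narrowOffset k t)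
  narrow-halfHop {k} {t} hk t< = cases (t ≤? k)
    where
    inner : ∀ {k} (hk : Halving k) → t ≤ k → HalfHop k (half hk) t
    inner (even r) t≤ = halfHop-near ≤-refl (narrow-hop-inner t≤)
    inner (odd r) t≤ with m≤n⇒m<n∨m≡n t≤
    ... | inj₁ t<1+2r = halfHop-near (n≤1+n (r + r)) (narrow-hop-inner (≤-pred t<1+2r))
    ... | inj₂ refl = halfHop-beyond (narrow-hop-inner ≤-refl)
    outer : ∀ {k j} (hk : Halving k) → 1 ≤ j → j < k → HalfHop k (half hk) (a + j)
    outer (even zero) 1≤j ()
    outer (even (suc r)) 1≤j j< = halfHop-near ≤-refl (narrow-hop-outer 1≤j (m<[1+n]+[1+n]⇒m≤1+[n+n] j<))
    outer (odd zero) (s≤s z≤n) (s≤s ())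
    outer (odd (suc r)) 1≤j j< with m≤n⇒m<n∨m≡n (≤-trans (≤-pred j<) (≤-reflexive (cong suc (+-suc r r))))
    ... | inj₁ j<2+2r = halfHop-near (n≤1+n _) (narrow-hop-outer 1≤j (≤-pred j<2+2r))
    ... | inj₂ refl = subst (HalfHop _ _) (sym (+-suc a (suc (r + r))))
                        (halfHop-beyond (narrow-hop-outer (s≤s z≤n) ≤-refl))
    cases : Dec (t ≤ k) → HalfHop k (half hk) (narrowOffset k t)
    cases (yes t≤k) = subst (HalfHop k (half hk)) (sym (narrowOffset-inner t≤k)) (inner hk t≤k)
    cases (no t≰k) = subst (HalfHop k (half hk)) (sym (narrowOffset-outer (≰⇒> t≰k)))
                       (outer hk (m<n⇒0<n∸m (≰⇒> t≰k)) (n≤m<n+n⇒m∸n<n (<⇒≤ (≰⇒> t≰k)) t<))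

  largeHalfBall : ∀ {k} → k + k ≤ n → ∀ v → LargeHalfBall v k
  largeHalfBall {k} k+k≤n = regime (h <? half hk)
    where
    hk : Halving k
    hk = halving k
    c≤n : half hk + half hk ≤ n
    c≤n = ≤-trans (half+half≤ hk) (≤-trans (m≤m+n k k) k+k≤n)
    regime : Dec (h < half hk) → ∀ v → LargeHalfBall v k
    regime (yes h<r) = largeHalfBall-of-offsets (half hk + half hk) c≤n
      toℕ toℕ-injective (λ t → <-≤-trans (toℕ<n t) k+k≤n) (λ t → wide-halfHop hk h<r (toℕ<n t))
    regime (no h≮r) = largeHalfBall-of-offsets (half hk) (≤-trans (m≤m+n (half hk) (half hk)) c≤n)
      (narrowOffset k ∘ toℕ) (toℕ-injective ∘ narrowOffset-injective k≤a)
      (λ t → narrowOffset<n k+k≤n (toℕ<n t)) (λ t → narrow-halfHop hk (toℕ<n t))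
      where
      k≤a : k ≤ a
      k≤a = ≤-trans (≤1+half+half hk) (s≤s (+-mono-≤ (≮⇒≥ h≮r) (≮⇒≥ h≮r)))

  β≤M : ∀ {f} → IsIndepBroadcast f → cost n f ≤ M
  β≤M {f} f-indep =
    m+m≤n+n⇒m≤n (subst (cost n f + cost n f ≤_) n≡M+M (packing f-indep (λ v → largeHalfBall (f+f≤n v) v)))
    where
    f+f≤n : ∀ v → f v + f v ≤ n
    f+f≤n v = subst (f v + f v ≤_) (sym n≡M+M) (+-mono-≤ f≤M f≤M)
      where
      f≤M : f v ≤ M
      f≤M = broadcast≤diameter walk≤M (proj₁ f-indep) v

  parity-%n : ∀ N → parity (N % n) ≡ parity N
  parity-%n N = sym (begin
    parity N                                          ≡⟨ cong parity (m≡m%n+[m/n]*n N n) ⟩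
    parity (N % n + N / n * n)                        ≡⟨ ℙ.+-homo-+ (N % n) (N / n * n) ⟩
    parity (N % n) ℙ.+ parity (N / n * n)             ≡⟨ cong (parity (N % n) ℙ.+_) (ℙ.*-homo-* (N / n) n) ⟩
    parity (N % n) ℙ.+ (parity (N / n) ℙ.* parity n)  ≡⟨ cong (λ p → parity (N % n) ℙ.+ (parity (N / n) ℙ.* p)) parity-n ⟩
    parity (N % n) ℙ.+ (parity (N / n) ℙ.* 0ℙ)        ≡⟨ cong (parity (N % n) ℙ.+_) (ℙ.*-zeroʳ (parity (N / n))) ⟩
    parity (N % n) ℙ.+ 0ℙ                             ≡⟨ ℙ.+-identityʳ (parity (N % n)) ⟩
    parity (N % n)                                    ∎)
    where
    open ≡-Reasoning
    parity-n : parity n ≡ 0ℙ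
    parity-n = trans (cong parity n≡M+M) (trans (ℙ.+-homo-+ M M) (ℙ.p+p≡0ℙ (parity M)))

  step-flips-parity : ∀ s {u v} → parity s ≡ 1ℙ → Step n s u v → parity (toℕ v) ≡ parity (toℕ u) ⁻¹
  step-flips-parity s {u} {v} s-odd st = begin
    parity (toℕ v)                 ≡⟨ cong parity st ⟩
    parity ((toℕ u + s) % n)       ≡⟨ parity-%n (toℕ u + s) ⟩
    parity (toℕ u + s)             ≡⟨ ℙ.+-homo-+ (toℕ u) s ⟩
    parity (toℕ u) ℙ.+ parity s    ≡⟨ cong (parity (toℕ u) ℙ.+_) s-odd ⟩
    parity (toℕ u) ℙ.+ 1ℙ          ≡⟨ ℙ.+-comm (parity (toℕ u)) 1ℙ ⟩
    parity (toℕ u) ⁻¹              ∎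
    where open ≡-Reasoning

  adj-flips-parity : ∀ {u v} → CAdj n a u v → parity (toℕ v) ≡ parity (toℕ u) ⁻¹
  adj-flips-parity {u} {v} (inj₁ st) = step-flips-parity 1 {u} {v} refl st
  adj-flips-parity {u} {v} (inj₂ (inj₁ st)) = ⁻¹-swap (step-flips-parity 1 {v} {u} refl st)
  adj-flips-parity {u} {v} (inj₂ (inj₂ (inj₁ st))) = step-flips-parity a {u} {v} (parity-odd h) st
  adj-flips-parity {u} {v} (inj₂ (inj₂ (inj₂ st))) = ⁻¹-swap (step-flips-parity a {v} {u} (parity-odd h) st)

  isEven : ℕ → Bool
  isEven x = isYes (parity x ℙ.≟ 0ℙ)

  evens : Subset n
  evens = Vec.tabulate (isEven ∘ toℕ)

  ∈evens⇒even : ∀ {v} → v ∈ evens → parity (toℕ v) ≡ 0ℙ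
  ∈evens⇒even {v} v∈ = toWitness {a? = parity (toℕ v) ℙ.≟ 0ℙ} (subst T isEven[v]≡true tt)
    where
    isEven[v]≡true : true ≡ isEven (toℕ v)
    isEven[v]≡true = trans (sym ([]=⇒lookup v∈)) (lookup∘tabulate (isEven ∘ toℕ) v)

  evens-independent : IsIndepSet (_∈ evens)
  evens-independent u v u∈ v∈ adj
    with trans (sym (∈evens⇒even v∈)) (trans (adj-flips-parity adj) (cong _⁻¹ (∈evens⇒even u∈)))
  ... | ()

  ∣evens∣≡M : ∣ evens ∣ ≡ M
  ∣evens∣≡M = begin
    ∣ evens ∣                        ≡⟨ ∣p∣≡∑indicator evens ⟩
    ∑ (indicator evens)              ≡⟨ sum-cong-≗ {n} (cong (λ b → if b then 1 else 0) ∘ lookup∘tabulate (isEven ∘ toℕ)) ⟩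
    ∑ {n} (evenIndicator ∘ toℕ)      ≡⟨ cong (λ N → ∑ {N} (evenIndicator ∘ toℕ)) n≡M+M ⟩
    ∑ {M + M} (evenIndicator ∘ toℕ)  ≡⟨ countEvens M ⟩
    M                                ∎
    where
    open ≡-Reasoning
    evenIndicator : ℕ → ℕ
    evenIndicator x = if isEven x then 1 else 0
    countEvens : ∀ K → ∑ {K + K} (evenIndicator ∘ toℕ) ≡ K
    countEvens zero = refl
    countEvens (suc K) = trans (cong (λ N → ∑ {suc N} (evenIndicator ∘ toℕ)) (+-suc K K)) (cong suc (countEvens K))

  circulant-β≡α≡M : BroadcastIndepNumberIs n a M × IndepNumberIs n a M
  circulant-β≡α≡M =
    ((indicator evens , indicator-indepBroadcast ecc≥1 evens-independent , trans (cost-indicator evens) ∣evens∣≡M) ,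
     λ _ → β≤M) ,
    ((evens , evens-independent , ∣evens∣≡M) ,
     λ S S-indep → subst (_≤ M) (cost-indicator S) (β≤M (indicator-indepBroadcast ecc≥1 S-indep)))
    where
    cost-indicator : ∀ S → cost n (indicator S) ≡ ∣ S ∣
    cost-indicator S = trans (cost≡∑ n (indicator S)) (sym (∣p∣≡∑indicator S))

theorem18 : (n a : ℕ) → 2 ∣ n → 6 ≤ n → ¬ (2 ∣ a) → 3 ≤ a → a ≤ n / 2 →
    BroadcastIndepNumberIs n a (n / 2) × IndepNumberIs n a (n / 2)
theorem18 n a (divides zero refl) () a-odd 3≤a a≤n/2
theorem18 n a (divides (suc q) refl) 6≤n a-odd 3≤a a≤n/2 with halving a
... | even r = ⊥-elim (a-odd (divides r (r+r≡r*2 r)))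
  where
  r+r≡r*2 : ∀ r → r + r ≡ r * 2
  r+r≡r*2 = solve-∀
... | odd h = subst (λ b → BroadcastIndepNumberIs n a b × IndepNumberIs n a b) (sym n/2≡1+q)
    (Circulant.circulant-β≡α≡M (suc (q * 2)) h (suc q) (2+q*2≡1+q+1+q q) (1≤h 3≤a)
      (subst (a ≤_) n/2≡1+q a≤n/2))
  where
  n/2≡1+q : suc q * 2 / 2 ≡ suc q
  n/2≡1+q = m*n/n≡m (suc q) 2
  2+q*2≡1+q+1+q : ∀ q → suc (suc (q * 2)) ≡ suc q + suc q
  2+q*2≡1+q+1+q = solve-∀
  1≤h : ∀ {h} → 3 ≤ suc (h + h) → 1 ≤ h
  1≤h {zero} (s≤s ())
  1≤h {suc h} _ = s≤s z≤n
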